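{- Let $G$ be a graph and $G_1,\ldots,G_k$ connected subgraphs of $G$ such that (i) $\{E(G_1),\ldots,E(G_k)\}$ is a partition of $E(G)$; (ii) every cycle of $G$ is contained in $G_i$ for some $i\in\{1,\ldots,k\}$; (iii) at least $k-1$ of $G_1,\ldots,G_k$ are vertex transitive. Then $p(G)=\sum_{i=1}^k p(G_i)$.
   Context: Graphs are finite and simple. For an acyclic digraph $D$, $P(D)$ is the graph on $V(D)$ with $uv$ an edge iff $(u,v)\in A(D)$ or $(v,u)\in A(D)$ or $u,v$ have a common out-neighbor in $D$. A phylogeny digraph for $G$ is an acyclic digraph $D$ with $G$ an induced subgraph of $P(D)$ and no arcs from $V(D)\setminus V(G)$ to $V(G)$; the phylogeny number $p(G)$ is the minimum of $|V(D)\setminus V(G)|$ over such $D$. -}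

module Defs where

open import Data.Nat using (ℕ; zero; suc; _≤_)
open import Data.Fin using (Fin; zero; suc; inject₁; fromℕ)
open import Data.Fin.Permutation using (Permutation′; _⟨$⟩ʳ_)
open import Data.Bool using (Bool; true; false; T)
open import Data.Sum using (_⊎_; inj₁; inj₂)
open import Data.Product using (Σ; ∃; ∃-syntax; _×_; _,_)
open import Data.List using (List; tabulate)
open import Data.Nat.ListAction using (sum)
open import Relation.Nullary using (¬_)
open import Relation.Binary.PropositionalEquality using (_≡_; _≢_)
open import Relation.Binary.Construct.Closure.ReflexiveTransitive using (Star)
open import Relation.Binary.Construct.Closure.Transitive using (TransClosure)
open import Function.Definitions using (Injective)
open import Function.Bundles using (_⇔_)

record Graph (n : ℕ) : Set where
  field
    adj    : Fin n → Fin n → Bool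
    sym    : ∀ x y → adj x y ≡ adj y x
    irrefl : ∀ x → adj x x ≡ false
open Graph public

Adj : ∀ {n} → Graph n → Fin n → Fin n → Set
Adj G x y = T (adj G x y)

-- connected: nonempty and any two vertices joined by a walk
Connected : ∀ {n} → Graph n → Set
Connected {n} G = Fin n × (∀ u v → Star (Adj G) u v)

IsAutomorphism : ∀ {n} → Graph n → Permutation′ n → Set
IsAutomorphism G σ = ∀ x y → adj G (σ ⟨$⟩ʳ x) (σ ⟨$⟩ʳ y) ≡ adj G x y

VertexTransitive : ∀ {n} → Graph n → Set
VertexTransitive {n} G =
  ∀ (u v : Fin n) → Σ (Permutation′ n) λ σ → IsAutomorphism G σ × (σ ⟨$⟩ʳ u ≡ v)

record Subgraph {n : ℕ} (G : Graph n) : Set where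
  field
    size  : ℕ
    graph : Graph size
    emb   : Fin size → Fin n
    emb-injective : Injective _≡_ _≡_ emb
    emb-edge : ∀ u v → Adj graph u v → Adj G (emb u) (emb v)
open Subgraph public

EdgeIn : ∀ {n} {G : Graph n} → Subgraph G → Fin n → Fin n → Set
EdgeIn H x y =
  ∃[ u ] ∃[ v ] (Adj (graph H) u v × emb H u ≡ x × emb H v ≡ y)

record Cycle {n : ℕ} (G : Graph n) : Set where
  field
    len    : ℕ                       -- the cycle has length suc (suc (suc len))
    vert   : Fin (suc (suc (suc len))) → Fin n
    vert-injective : Injective _≡_ _≡_ vert
    step   : ∀ (j : Fin (suc (suc len))) → Adj G (vert (inject₁ j)) (vert (suc j))
    close  : Adj G (vert (fromℕ (suc (suc len)))) (vert zero)
open Cycle public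

-- every edge of the cycle lies in E(H) (hence also every vertex in V(H))
CycleIn : ∀ {n} {G : Graph n} → Cycle G → Subgraph G → Set
CycleIn C H =
  (∀ (j : Fin (suc (suc (len C)))) → EdgeIn H (vert C (inject₁ j)) (vert C (suc j)))
  × EdgeIn H (vert C (fromℕ (suc (suc (len C))))) (vert C zero)

record Digraph (V : Set) : Set where
  field
    arc : V → V → Bool
open Digraph public

Arc : ∀ {V} → Digraph V → V → V → Set
Arc D x y = T (arc D x y)

Acyclic : ∀ {V} → Digraph V → Set
Acyclic D = ∀ v → ¬ TransClosure (Arc D) v v

PAdj : ∀ {V} → Digraph V → V → V → Set
PAdj {V} D u v = Arc D u v ⊎ Arc D v u ⊎ (∃[ w ] (Arc D u w × Arc D v w))

-- D is a phylogeny digraph for G with m extra vertices: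
-- V(D) = V(G) ⊎ (m new vertices)
IsPhylogenyDigraph : ∀ {n} (G : Graph n) (m : ℕ) → Digraph (Fin n ⊎ Fin m) → Set
IsPhylogenyDigraph G m D =
  Acyclic D
  × (∀ u v → u ≢ v → (Adj G u v ⇔ PAdj D (inj₁ u) (inj₁ v)))
  × (∀ a u → ¬ Arc D (inj₂ a) (inj₁ u))

HasPhylogenyDigraph : ∀ {n} → Graph n → ℕ → Set
HasPhylogenyDigraph G m = Σ (Digraph _) (IsPhylogenyDigraph G m)

IsPhylogenyNumber : ∀ {n} → Graph n → ℕ → Set
IsPhylogenyNumber G m =
  HasPhylogenyDigraph G m × (∀ m′ → HasPhylogenyDigraph G m′ → m ≤ m′)

EdgePartition : ∀ {n k} (G : Graph n) → (Fin k → Subgraph G) → Set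
EdgePartition G Gs =
  (∀ x y → Adj G x y → ∃[ i ] EdgeIn (Gs i) x y)
  × (∀ i j x y → EdgeIn (Gs i) x y → EdgeIn (Gs j) x y → i ≡ j)
  × (∀ i → ∃[ x ] ∃[ y ] EdgeIn (Gs i) x y)

sumFin : ∀ {k} → (Fin k → ℕ) → ℕ
sumFin f = sum (tabulate f)

module Submission where

-- The cycle hypothesis enters through two facts (Pieces): every triangle
-- lies in one piece, and no walk leaves a piece and re-enters it elsewhere.
-- Lower bound (Restriction): a phylogeny digraph of G restricts to each G_i,
-- the extra vertices used by different pieces being disjoint.
-- Upper bound: rank the vertices of G by distance to a root of their
-- component (Rank); each piece then has a unique lowest vertex, its root,
-- and a vertex shared by two pieces is the root of one (PieceRoots).  Make
-- each root a source of an optimal digraph of its piece, by automorphisms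
-- (PhylogenyDigraphs), and glue these digraphs (Gluing): a directed cycle
-- changing pieces would strictly raise the ranks of the roots it meets.

module Walks where

  open import Data.Nat using (ℕ; zero; suc; _<_)
  open import Data.Fin using (Fin; zero; suc; inject₁; fromℕ)
  open import Data.Fin.Properties using (injective⇒≤)
  open import Data.List using (List; []; _∷_)
  open import Data.List.Relation.Unary.Any using (here; there)
  open import Data.List.Membership.Propositional using (_∈_; _∉_)
  open import Data.Product using (Σ-syntax; ∃-syntax; _×_; _,_; proj₂)
  open import Data.Sum using (_⊎_; inj₁; inj₂)
  open import Data.Unit using (⊤; tt)
  open import Data.Empty using (⊥-elim)
  open import Relation.Nullary using (¬_; Dec; yes; no)
  open import Relation.Binary.Definitions using (DecidableEquality)
  open import Relation.Binary.PropositionalEquality using (_≡_; refl; cong; subst; sym)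
  open import Relation.Binary.Construct.Closure.ReflexiveTransitive
    using (Star; ε; _◅_; _◅◅_; map; gmap; revApp; reverse)
  open import Function.Definitions using (Injective)

  module _ {A : Set} {R : A → A → Set} where

    verts : ∀ {a b} → Star R a b → List A
    verts {a} ε = a ∷ []
    verts {a} (e ◅ p) = a ∷ verts p

    steps : ∀ {a b} → Star R a b → ℕ
    steps ε = 0
    steps (e ◅ p) = suc (steps p)

    start∈ : ∀ {a b} (p : Star R a b) → a ∈ verts p
    start∈ ε = here refl
    start∈ (e ◅ p) = here refl

    end∈ : ∀ {a b} (p : Star R a b) → b ∈ verts p
    end∈ ε = here refl
    end∈ (e ◅ p) = there (end∈ p)

    ∈-◅◅⁻ : ∀ {a b c w} (p : Star R a b) (q : Star R b c) →
            w ∈ verts (p ◅◅ q) → w ∈ verts p ⊎ w ∈ verts q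
    ∈-◅◅⁻ ε q m = inj₂ m
    ∈-◅◅⁻ (e ◅ p) q (here eq) = inj₁ (here eq)
    ∈-◅◅⁻ (e ◅ p) q (there m) with ∈-◅◅⁻ p q m
    ... | inj₁ m′ = inj₁ (there m′)
    ... | inj₂ m′ = inj₂ m′

    Simple : ∀ {a b} → Star R a b → Set
    Simple ε = ⊤
    Simple {a} (e ◅ p) = a ∉ verts p × Simple p

    simple-◅◅ : ∀ {a b c} (p : Star R a b) (q : Star R b c) → Simple p → Simple q →
                (∀ {w} → w ∈ verts p → w ∈ verts q → w ≡ b) → Simple (p ◅◅ q)
    simple-◅◅ ε q _ sq _ = sq
    simple-◅◅ {a} (e ◅ p) q (a∉p , sp) sq meet =
      a∉p◅◅q , simple-◅◅ p q sp sq (λ m → meet (there m))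
      where
      a∉p◅◅q : a ∉ verts (p ◅◅ q)
      a∉p◅◅q m with ∈-◅◅⁻ p q m
      ... | inj₁ a∈p = a∉p a∈p
      ... | inj₂ a∈q with meet (here refl) a∈q
      ...   | refl = a∉p (end∈ p)

    AllSteps : (A → A → Set) → ∀ {a b} → Star R a b → Set
    AllSteps P ε = ⊤
    AllSteps P {a} (_◅_ {j = b} e p) = P a b × AllSteps P p

    AllSteps-◅◅ʳ : ∀ {P : A → A → Set} {a b c} (p : Star R a b) (q : Star R b c) →
                   AllSteps P (p ◅◅ q) → AllSteps P q
    AllSteps-◅◅ʳ ε q all = all
    AllSteps-◅◅ʳ (e ◅ p) q (_ , all) = AllSteps-◅◅ʳ p q all

    -- the walk as a function from positions 0 … steps to vertices; on a
    -- path it is injective, which is what turns closed paths into 'Cycle's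
    vertexAt : ∀ {a b} (p : Star R a b) → Fin (suc (steps p)) → A
    vertexAt {a} ε zero = a
    vertexAt {a} (e ◅ p) zero = a
    vertexAt (e ◅ p) (suc i) = vertexAt p i

    vertexAt-first : ∀ {a b} (p : Star R a b) → vertexAt p zero ≡ a
    vertexAt-first ε = refl
    vertexAt-first (e ◅ p) = refl

    vertexAt-last : ∀ {a b} (p : Star R a b) → vertexAt p (fromℕ (steps p)) ≡ b
    vertexAt-last ε = refl
    vertexAt-last (e ◅ p) = vertexAt-last p

    vertexAt∈ : ∀ {a b} (p : Star R a b) (i : Fin (suc (steps p))) → vertexAt p i ∈ verts p
    vertexAt∈ ε zero = here refl
    vertexAt∈ (e ◅ p) zero = here refl
    vertexAt∈ (e ◅ p) (suc i) = there (vertexAt∈ p i)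

    vertexAt-step : ∀ {a b} (p : Star R a b) (i : Fin (steps p)) →
                    R (vertexAt p (inject₁ i)) (vertexAt p (suc i))
    vertexAt-step (e ◅ p) zero = subst (R _) (sym (vertexAt-first p)) e
    vertexAt-step (e ◅ p) (suc i) = vertexAt-step p i

    vertexAt-injective : ∀ {a b} (p : Star R a b) → Simple p → Injective _≡_ _≡_ (vertexAt p)
    vertexAt-injective ε _ {zero} {zero} _ = refl
    vertexAt-injective (e ◅ p) _ {zero} {zero} _ = refl
    vertexAt-injective (e ◅ p) (a∉p , _) {zero} {suc j} eq =
      ⊥-elim (a∉p (subst (_∈ verts p) (sym eq) (vertexAt∈ p j)))
    vertexAt-injective (e ◅ p) (a∉p , _) {suc i} {zero} eq =
      ⊥-elim (a∉p (subst (_∈ verts p) eq (vertexAt∈ p i)))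
    vertexAt-injective (e ◅ p) (_ , sp) {suc i} {suc j} eq =
      cong suc (vertexAt-injective p sp eq)

    allSteps-vertexAt : ∀ {P : A → A → Set} {a b} (p : Star R a b) →
                        (∀ i → P (vertexAt p (inject₁ i)) (vertexAt p (suc i))) → AllSteps P p
    allSteps-vertexAt ε _ = tt
    allSteps-vertexAt {P} (e ◅ p) each =
      subst (P _) (vertexAt-first p) (each zero) , allSteps-vertexAt p (λ i → each (suc i))

    suffix : ∀ {a b w} (p : Star R a b) → w ∈ verts p →
             Σ[ q ∈ Star R w b ] ((Simple p → Simple q) × (∀ {x} → x ∈ verts q → x ∈ verts p))
    suffix ε (here refl) = ε , (λ s → s) , (λ m → m)
    suffix (e ◅ p) (here refl) = e ◅ p , (λ s → s) , (λ m → m)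
    suffix (e ◅ p) (there w∈p) with suffix p w∈p
    ... | q , simple , sub = q , (λ s → simple (proj₂ s)) , (λ m → there (sub m))

    module _ (_≟_ : DecidableEquality A) where
      open import Data.List.Membership.DecPropositional _≟_ using (_∈?_)

      shortcut : ∀ {a b} (p : Star R a b) →
                 Σ[ q ∈ Star R a b ] (Simple q × (∀ {w} → w ∈ verts q → w ∈ verts p))
      shortcut ε = ε , tt , (λ m → m)
      shortcut {a} (e ◅ p) with shortcut p
      ... | q , sq , sub with a ∈? verts q
      ...   | yes a∈q = let q′ , simple , sub′ = suffix q a∈q in q′ , simple sq , (λ m → there (sub (sub′ m)))
      ...   | no a∉q = e ◅ q , (a∉q , sq) , λ { (here eq) → here eq ; (there m) → there (sub m) }

  steps<-simple : ∀ {n} {R : Fin n → Fin n → Set} {a b} (p : Star R a b) → Simple p → steps p < n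
  steps<-simple p sp = injective⇒≤ (vertexAt-injective p sp)

  module _ {A : Set} {R S : A → A → Set} (f : ∀ {x y} → R x y → S x y) where

    verts-map : ∀ {a b} (p : Star R a b) → verts (map f p) ≡ verts p
    verts-map ε = refl
    verts-map (e ◅ p) = cong (_ ∷_) (verts-map p)

    simple-map : ∀ {a b} (p : Star R a b) → Simple p → Simple (map f p)
    simple-map ε _ = tt
    simple-map (e ◅ p) (a∉p , sp) = subst (_ ∉_) (sym (verts-map p)) a∉p , simple-map p sp

  refine : ∀ {A : Set} {R S : A → A → Set} (P : A → Set) →
           (∀ {x y} → P x → P y → R x y → S x y) →
           ∀ {a b} (p : Star R a b) → (∀ {w} → w ∈ verts p → P w) →
           Σ[ q ∈ Star S a b ] verts q ≡ verts p
  refine P f ε _ = ε , refl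
  refine P f {a} (_◅_ {j = b} e p) all with refine P f p (λ m → all (there m))
  ... | q , eq = f (all (here refl)) (all (there (subst (b ∈_) eq (start∈ q)))) e ◅ q , cong (a ∷_) eq

  cut : ∀ {A : Set} {R : A → A → Set} (Q : A → Set) → (∀ a → Dec (Q a)) → ∀ {a b} (p : Star R a b) → Q b →
        ∃[ x ] (Q x × Σ[ q ∈ Star (λ u v → R u v × ¬ Q u) a x ]
                 ((∀ {w} → w ∈ verts q → w ∈ verts p) × (∀ {w} → w ∈ verts q → w ≡ x ⊎ ¬ Q w)))
  cut Q Q? {a} ε qa = a , qa , ε , (λ m → m) , λ { (here refl) → inj₁ refl }
  cut Q Q? {a} (e ◅ p) qb with Q? a
  ... | yes qa = a , qa , ε , (λ { (here refl) → here refl }) , λ { (here refl) → inj₁ refl }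
  ... | no ¬qa with cut Q Q? p qb
  ...   | x , qx , q , sub , outside = x , qx , (e , ¬qa) ◅ q ,
          (λ { (here eq) → here eq ; (there m) → there (sub m) }) ,
          λ { (here refl) → inj₂ ¬qa ; (there m) → outside m }

  module _ {A : Set} {R : A → A → Set} (flip : ∀ {x y} → R x y → R y x) where

    ∈-revApp : ∀ {a b c w} (p : Star R b a) (q : Star R b c) →
               w ∈ verts (revApp flip p q) → w ∈ verts p ⊎ w ∈ verts q
    ∈-revApp ε q m = inj₂ m
    ∈-revApp (e ◅ p) q m with ∈-revApp p (flip e ◅ q) m
    ... | inj₁ m′ = inj₁ (there m′)
    ... | inj₂ (here refl) = inj₁ (there (start∈ p))
    ... | inj₂ (there m′) = inj₂ m′

    ∈-reverse : ∀ {a b w} (p : Star R a b) → w ∈ verts (reverse flip p) → w ∈ verts p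
    ∈-reverse p m with ∈-revApp p ε m
    ... | inj₁ m′ = m′
    ... | inj₂ (here refl) = start∈ p

  module _ {A B : Set} {R : A → A → Set} {S : B → B → Set}
           (f : A → B) (g : ∀ {x y} → R x y → S (f x) (f y)) where

    ∈-gmap : ∀ {a b w} (p : Star R a b) → w ∈ verts (gmap {U = S} f g p) → ∃[ u ] (u ∈ verts p × f u ≡ w)
    ∈-gmap ε (here eq) = _ , here refl , sym eq
    ∈-gmap (e ◅ p) (here eq) = _ , here refl , sym eq
    ∈-gmap (e ◅ p) (there m) with ∈-gmap p m
    ... | u , u∈p , eq = u , there u∈p , eq

    simple-gmap : Injective _≡_ _≡_ f → ∀ {a b} (p : Star R a b) → Simple p → Simple (gmap {U = S} f g p)
    simple-gmap f-inj ε _ = tt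
    simple-gmap f-inj {a} (e ◅ p) (a∉p , sp) = a∉ , simple-gmap f-inj p sp
      where
      a∉ : f a ∉ verts (gmap {U = S} f g p)
      a∉ m with ∈-gmap p m
      ... | u , u∈p , eq = a∉p (subst (_∈ verts p) (f-inj eq) u∈p)

module Pieces where

  open import Defs hiding (sym)
  open Walks
  open import Data.Nat using (_≤_; z≤n; s≤s)
  open import Data.Fin using (Fin)
  open import Data.Fin.Properties using (any?; _≟_)
  open import Data.List.Relation.Unary.Any using (here; there)
  open import Data.List.Membership.Propositional using (_∈_)
  open import Data.Product using (Σ-syntax; ∃-syntax; _×_; _,_; proj₁; proj₂)
  open import Data.Sum using (_⊎_; inj₁; inj₂)
  open import Data.Unit using (tt)
  open import Data.Empty using (⊥; ⊥-elim)
  open import Data.Bool using (T)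
  open import Relation.Nullary using (¬_; Dec)
  open import Relation.Binary.PropositionalEquality using (_≡_; _≢_; refl; sym; subst)
  open import Relation.Binary.Construct.Closure.ReflexiveTransitive using (Star; ε; _◅_; _◅◅_; map; gmap)

  adjSym : ∀ {n} (H : Graph n) {x y} → Adj H x y → Adj H y x
  adjSym H {x} {y} = subst T (Graph.sym H x y)

  adj≢ : ∀ {n} (H : Graph n) {x y} → Adj H x y → x ≢ y
  adj≢ H {x} a refl = subst T (irrefl H x) a

  edgeSym : ∀ {n} {G : Graph n} (H : Subgraph G) {x y} → EdgeIn H x y → EdgeIn H y x
  edgeSym H (u , v , a , eu , ev) = v , u , adjSym (graph H) a , ev , eu

  edgeAdj : ∀ {n} {G : Graph n} (H : Subgraph G) {x y} → EdgeIn H x y → Adj G x y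
  edgeAdj H (u , v , a , refl , refl) = emb-edge H u v a

  toCycle : ∀ {n} {G : Graph n} {a b} (p : Star (Adj G) a b) → Simple p → 2 ≤ steps p → Adj G b a →
            Σ[ C ∈ Cycle G ] (∀ H → CycleIn C H → EdgeIn H b a × AllSteps (EdgeIn H) p)
  toCycle {G = G} {a} {b} p@(_ ◅ _ ◅ _) sp (s≤s (s≤s _)) close = C , edges
    where
    C : Cycle G
    C = record { len = _ ; vert = vertexAt p ; vert-injective = vertexAt-injective p sp
               ; step = vertexAt-step p ; close = subst (λ z → Adj G z a) (sym (vertexAt-last p)) close }
    edges : ∀ H → CycleIn C H → EdgeIn H b a × AllSteps (EdgeIn H) p
    edges H (along , closing) =
      subst (λ z → EdgeIn H z a) (vertexAt-last p) closing , allSteps-vertexAt p along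

  module Decomposition {n k} (G : Graph n) (Gs : Fin k → Subgraph G)
                       (conn : ∀ i → Connected (graph (Gs i))) (part : EdgePartition G Gs)
                       (cyc : ∀ (C : Cycle G) → ∃[ i ] CycleIn C (Gs i)) where

    In : Fin k → Fin n → Set
    In j x = ∃[ a ] emb (Gs j) a ≡ x

    In? : ∀ j x → Dec (In j x)
    In? j x = any? (λ a → emb (Gs j) a ≟ x)

    edgeIn : ∀ {j x y} → EdgeIn (Gs j) x y → In j x × In j y
    edgeIn (u , v , _ , eu , ev) = (u , eu) , (v , ev)

    Outside : Fin k → Fin n → Fin n → Set
    Outside j a b = Adj G a b × ¬ EdgeIn (Gs j) a b

    edge-unique : ∀ {i j x y} → EdgeIn (Gs i) x y → EdgeIn (Gs j) x y → i ≡ j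
    edge-unique {i} {j} {x} {y} = proj₁ (proj₂ part) i j x y

    cycle-in-piece : ∀ j {a b} (p : Star (Adj G) a b) → Simple p → 2 ≤ steps p →
                     EdgeIn (Gs j) b a → AllSteps (EdgeIn (Gs j)) p
    cycle-in-piece j p sp long closing with toCycle p sp long (edgeAdj (Gs j) closing)
    ... | C , edges with cyc C
    ...   | t , C⊆t with edges (Gs t) C⊆t
    ...     | closing′ , along with edge-unique closing′ closing
    ...       | refl = along

    triangle : ∀ i {x y z} → y ≢ z → z ≢ x → EdgeIn (Gs i) x y → Adj G y z → Adj G z x →
               EdgeIn (Gs i) y z × EdgeIn (Gs i) z x
    triangle i y≢z z≢x xy yz zx with cycle-in-piece i (yz ◅ zx ◅ ε) simple (s≤s (s≤s z≤n)) xy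
      where
      simple = (λ { (here y≡z) → y≢z y≡z ; (there (here y≡x)) → adj≢ G (edgeAdj (Gs i) xy) (sym y≡x) })
             , (λ { (here z≡x) → z≢x z≡x }) , tt
    ... | e₁ , e₂ , _ = e₁ , e₂

    piecePath : ∀ j a b → Σ[ Q ∈ Star (EdgeIn (Gs j)) (emb (Gs j) a) (emb (Gs j) b) ]
                          (Simple Q × (∀ {w} → w ∈ verts Q → In j w))
    piecePath j a b with shortcut _≟_ (proj₂ (conn j) a b)
    ... | Q , simple , _ =
      gmap {U = EdgeIn (Gs j)} (emb (Gs j)) toEdge Q ,
      simple-gmap (emb (Gs j)) toEdge (emb-injective (Gs j)) Q simple ,
      λ m → let u , _ , eq = ∈-gmap (emb (Gs j)) toEdge Q m in u , eq
      where
      toEdge : ∀ {u v} → Adj (graph (Gs j)) u v → EdgeIn (Gs j) (emb (Gs j) u) (emb (Gs j) v)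
      toEdge {u} {v} a = u , v , a , refl , refl

    -- A path Q of G_j from x to v and a path S from v back to x that starts
    -- with an edge outside G_j and meets G_j only at v and x would form a
    -- cycle not contained in one piece.
    private
      detour-cycle : ∀ j {x v} (Q : Star (EdgeIn (Gs j)) x v) → Simple Q → (∀ {w} → w ∈ verts Q → In j w) →
                     (S : Star (Outside j) v x) → Simple S →
                     (∀ {w} → w ∈ verts S → w ≡ v ⊎ w ≡ x ⊎ ¬ In j w) → x ≢ v → ⊥
      detour-cycle j ε _ _ _ _ _ x≢v = x≢v refl
      detour-cycle j (_ ◅ _) _ _ ε _ _ x≢v = x≢v refl
      detour-cycle j {x} {v} (_◅_ {j = q₁} q Q) (x∉Q , sQ) inQ S@(s ◅ S′) sS onS _ =
        proj₂ s (proj₁ (AllSteps-◅◅ʳ Q′ S″ (cycle-in-piece j (Q′ ◅◅ S″) simple (long q Q s S′) q)))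
        where
        Q′ : Star (Adj G) q₁ v
        Q′ = map (edgeAdj (Gs j)) Q
        S″ : Star (Adj G) v x
        S″ = map proj₁ S
        meet : ∀ {w} → w ∈ verts Q′ → w ∈ verts S″ → w ≡ v
        meet {w} w∈Q w∈S with onS (subst (w ∈_) (verts-map proj₁ S) w∈S)
        ... | inj₁ w≡v = w≡v
        ... | inj₂ (inj₁ refl) = ⊥-elim (x∉Q (subst (w ∈_) (verts-map _ Q) w∈Q))
        ... | inj₂ (inj₂ w∉j) = ⊥-elim (w∉j (inQ (there (subst (w ∈_) (verts-map _ Q) w∈Q))))
        simple : Simple (Q′ ◅◅ S″)
        simple = simple-◅◅ Q′ S″ (simple-map _ Q sQ) (simple-map proj₁ S sS) meet
        -- the cycle is not a digon: the edge xv of G_j cannot be followed by vx outside G_j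
        long : ∀ {q₁ s₁} → EdgeIn (Gs j) x q₁ → (Q : Star (EdgeIn (Gs j)) q₁ v) →
               (s : Outside j v s₁) (S′ : Star (Outside j) s₁ x) →
               2 ≤ steps (map (edgeAdj (Gs j)) Q ◅◅ proj₁ s ◅ map proj₁ S′)
        long q ε s ε = ⊥-elim (proj₂ s (edgeSym (Gs j) q))
        long _ ε _ (_ ◅ _) = s≤s (s≤s z≤n)
        long _ (_ ◅ ε) _ _ = s≤s (s≤s z≤n)
        long _ (_ ◅ _ ◅ _) _ _ = s≤s (s≤s z≤n)

    no-detour : ∀ j {v x} (W : Star (Outside j) v x) → (∀ {w} → w ∈ verts W → w ≡ v ⊎ w ≡ x ⊎ ¬ In j w) →
                v ≢ x → In j v → In j x → ⊥
    no-detour j W onW v≢x (a , refl) (b , refl) with piecePath j b a | shortcut _≟_ W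
    ... | Q , sQ , inQ | S , sS , S⊆W = detour-cycle j Q sQ inQ S sS (λ m → onW (S⊆W m)) (λ x≡v → v≢x (sym x≡v))

module Rank where

  -- The rank of a vertex: its distance in G to the root of its connected
  -- component, where the component of a chosen vertex s is rooted at s and
  -- every other component at its vertex of least index.  Everything is
  -- decidable because reachability within t steps is.

  open import Defs hiding (sym)
  open Walks
  open Pieces using (adjSym)
  open import Data.Nat using (ℕ; zero; suc; _≤_; _<_; z≤n; s≤s; _<?_)
  open import Data.Nat.Properties using (≤-antisym; ≮⇒≥; <-cmp; <-irrefl; <-≤-trans; <⇒≤)
  open import Data.Fin using (Fin; zero; suc; toℕ; fromℕ; fromℕ<)
  open import Data.Fin.Properties using (any?; all?; toℕ-injective; toℕ<n; toℕ-fromℕ; toℕ-fromℕ<; _≟_)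
  open import Data.Product using (Σ-syntax; ∃-syntax; _×_; _,_; proj₁; proj₂)
  open import Data.Sum using (_⊎_; inj₁; inj₂)
  open import Data.Empty using (⊥-elim)
  open import Data.Bool.Properties using (T?)
  open import Relation.Nullary using (¬_; Dec; yes; no)
  open import Relation.Nullary.Decidable using (_×-dec_; _⊎-dec_; ¬?; _→-dec_)
  open import Relation.Binary.PropositionalEquality using (_≡_; refl; sym; subst)
  open import Relation.Binary.Construct.Closure.ReflexiveTransitive using (Star; ε; _◅_; _◅◅_; reverse)
  open import Relation.Binary using (tri<; tri≈; tri>)

  leastFin : ∀ {n} (P : Fin n → Set) → (∀ x → Dec (P x)) → ∀ x → P x →
             Σ[ y ∈ Fin n ] (P y × (∀ y′ → toℕ y′ < toℕ y → ¬ P y′))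
  leastFin {suc n} P P? x px with P? zero
  ... | yes p0 = zero , p0 , λ _ ()
  leastFin {suc n} P P? zero px | no ¬p0 = ⊥-elim (¬p0 px)
  leastFin {suc n} P P? (suc x) px | no ¬p0 with leastFin (λ y → P (suc y)) (λ y → P? (suc y)) x px
  ... | y , py , below = suc y , py , λ { zero _ → ¬p0 ; (suc y′) (s≤s lt) → below y′ lt }

  least : (P : ℕ → Set) → (∀ t → Dec (P t)) → ∀ N → P N →
          Σ[ t ∈ ℕ ] (P t × (∀ t′ → P t′ → t ≤ t′))
  least P P? N pN with leastFin (λ x → P (toℕ x)) (λ x → P? (toℕ x)) (fromℕ N) (subst P (sym (toℕ-fromℕ N)) pN)
  ... | y , py , below = toℕ y , py , minimal
    where
    minimal : ∀ t′ → P t′ → toℕ y ≤ t′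
    minimal t′ pt′ = ≮⇒≥ λ t′<y →
      let t′<N+1 = <-≤-trans t′<y (<⇒≤ (toℕ<n y))
      in below (fromℕ< t′<N+1) (subst (_< toℕ y) (sym (toℕ-fromℕ< t′<N+1)) t′<y)
               (subst P (sym (toℕ-fromℕ< t′<N+1)) pt′)

  module RankFrom {n} (G : Graph n) (s : Fin n) where

    Reach : Fin n → Fin n → Set
    Reach = Star (Adj G)

    reachSym : ∀ {a b} → Reach a b → Reach b a
    reachSym = reverse (adjSym G)

    Within : ℕ → Fin n → Fin n → Set
    Within zero z v = z ≡ v
    Within (suc t) z v = Within t z v ⊎ ∃[ w ] (Within t z w × Adj G w v)

    Within? : ∀ t z v → Dec (Within t z v)
    Within? zero z v = z ≟ v
    Within? (suc t) z v = Within? t z v ⊎-dec any? (λ w → Within? t z w ×-dec T? (adj G w v))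

    within-sound : ∀ t {z v} → Within t z v → Reach z v
    within-sound zero refl = ε
    within-sound (suc t) (inj₁ r) = within-sound t r
    within-sound (suc t) (inj₂ (w , r , a)) = within-sound t r ◅◅ (a ◅ ε)

    within-◅ : ∀ t {z w v} → Adj G z w → Within t w v → Within (suc t) z v
    within-◅ zero a refl = inj₂ (_ , refl , a)
    within-◅ (suc t) a (inj₁ r) = inj₁ (within-◅ t a r)
    within-◅ (suc t) a (inj₂ (u , r , a′)) = inj₂ (u , within-◅ t a r , a′)

    within-mono : ∀ {t t′ z v} → t ≤ t′ → Within t z v → Within t′ z v
    within-mono {zero} {zero} _ r = r
    within-mono {zero} {suc t′} _ r = inj₁ (within-mono {zero} {t′} z≤n r)
    within-mono {suc t} {suc t′} (s≤s le) (inj₁ r) = inj₁ (within-mono le r)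
    within-mono {suc t} {suc t′} (s≤s le) (inj₂ (w , r , a)) = inj₂ (w , within-mono le r , a)

    within-walk : ∀ {z v} (p : Reach z v) → Within (steps p) z v
    within-walk ε = refl
    within-walk (e ◅ p) = within-◅ _ e (within-walk p)

    -- a reachable vertex is reachable along a path, hence within n steps
    reach-within : ∀ {z v} → Reach z v → Within n z v
    reach-within p with shortcut _≟_ p
    ... | q , simple , _ = within-mono (<⇒≤ (steps<-simple q simple)) (within-walk q)

    reach? : ∀ a b → Dec (Reach a b)
    reach? a b with Within? n a b
    ... | yes r = yes (within-sound n r)
    ... | no ¬r = no λ r → ¬r (reach-within r)

    Root : Fin n → Set
    Root z = z ≡ s ⊎ (¬ Reach s z × (∀ w → toℕ w < toℕ z → ¬ Reach w z))

    Root? : ∀ z → Dec (Root z)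
    Root? z = (z ≟ s) ⊎-dec (¬? (reach? s z) ×-dec all? (λ w → (toℕ w <? toℕ z) →-dec ¬? (reach? w z)))

    root-unique : ∀ {z z′} → Root z → Root z′ → Reach z z′ → z ≡ z′
    root-unique (inj₁ refl) (inj₁ refl) r = refl
    root-unique (inj₁ refl) (inj₂ (¬r , _)) r = ⊥-elim (¬r r)
    root-unique (inj₂ (¬r , _)) (inj₁ refl) r = ⊥-elim (¬r (reachSym r))
    root-unique {z} {z′} (inj₂ (_ , least-z)) (inj₂ (_ , least-z′)) r with <-cmp (toℕ z) (toℕ z′)
    ... | tri< lt _ _ = ⊥-elim (least-z′ z lt r)
    ... | tri≈ _ eq _ = toℕ-injective eq
    ... | tri> _ _ gt = ⊥-elim (least-z z′ gt (reachSym r))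

    root-exists : ∀ v → Σ[ z ∈ Fin n ] (Root z × Reach z v)
    root-exists v with reach? s v
    ... | yes r = s , inj₁ refl , r
    ... | no ¬r with leastFin (λ w → Reach w v) (λ w → reach? w v) v ε
    ...   | w , r , below =
      w , inj₂ ((λ r′ → ¬r (r′ ◅◅ r)) , (λ w′ lt r′ → below w′ lt (r′ ◅◅ r))) , r

    RootWithin : Fin n → ℕ → Set
    RootWithin v t = ∃[ z ] (Root z × Within t z v)

    LeastRootDistance : Fin n → ℕ → Set
    LeastRootDistance v t = RootWithin v t × (∀ t′ → RootWithin v t′ → t ≤ t′)

    abstract
      rank′ : ∀ v → Σ[ t ∈ ℕ ] LeastRootDistance v t
      rank′ v with root-exists v
      ... | z , root , r =
        least (RootWithin v) (λ t → any? (λ z → Root? z ×-dec Within? t z v)) n (z , root , reach-within r)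

      -- the rank of v: its distance to the nearest (indeed the only) root it reaches
      rank : Fin n → ℕ
      rank v = proj₁ (rank′ v)

      rank-minimal : ∀ v t → RootWithin v t → rank v ≤ t
      rank-minimal v = proj₂ (proj₂ (rank′ v))

      rank0⇒root : ∀ v → rank v ≡ 0 → Root v
      rank0⇒root v = root-of (rank′ v)
        where
        root-of : (r : Σ[ t ∈ ℕ ] LeastRootDistance v t) → proj₁ r ≡ 0 → Root v
        root-of (.zero , (z , root , z≡v) , _) refl = subst Root z≡v root

      rank-s : rank s ≡ 0
      rank-s = ≤-antisym (rank-minimal s 0 (s , inj₁ refl , refl)) z≤n

      rank-descend : ∀ v t → rank v ≡ suc t → ∃[ w ] (Adj G v w × rank w ≤ t)
      rank-descend v t = descend (rank′ v)
        where
        descend : (r : Σ[ t′ ∈ ℕ ] LeastRootDistance v t′) →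
                  proj₁ r ≡ suc t → ∃[ w ] (Adj G v w × rank w ≤ t)
        descend (.(suc t) , (z , root , inj₁ r) , minimal) refl = ⊥-elim (<-irrefl refl (minimal t (z , root , r)))
        descend (.(suc t) , (z , root , inj₂ (w , r , a)) , _) refl = w , adjSym G a , rank-minimal w t (z , root , r)

module PieceRoots where

  -- Rank the vertices of G from a vertex s (module Rank) and call the
  -- vertex of least rank of a piece G_j its root r_j.  Under the cycle
  -- hypothesis the root is the unique vertex of least rank of its piece
  -- ('root-strict'), and a vertex shared by two pieces is the root of one
  -- of them ('shared-is-root').  Both facts come from 'no-detour' applied
  -- to walks that descend in rank to the root of the component and back.

  open import Defs hiding (sym)
  open Walks
  open Pieces
  open Rank
  open import Data.Nat using (ℕ; zero; suc; _≤_; _<_; z≤n; s≤s)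
  open import Data.Nat.Properties
    using (≤-refl; ≤-trans; ≤-antisym; ≤∧≢⇒<; <-trans; <-≤-trans; ≤-<-trans; n≮n)
  open import Data.Fin using (Fin)
  open import Data.Fin.Properties using (_≟_)
  open import Data.List.Relation.Unary.Any using (here; there)
  open import Data.List.Membership.Propositional using (_∈_)
  open import Data.List.Membership.Propositional.Properties using (∈-allFin)
  open import Data.List using (allFin)
  open import Data.List.Extrema.Nat using (argmin; f[argmin]≤f[xs])
  import Data.List.Relation.Unary.All as All
  open import Data.Product using (Σ-syntax; ∃-syntax; _×_; _,_; proj₁; proj₂)
  open import Data.Sum using (_⊎_; inj₁; inj₂)
  open import Data.Empty using (⊥; ⊥-elim)
  open import Relation.Nullary using (¬_; yes; no)
  open import Relation.Binary.PropositionalEquality using (_≡_; _≢_; refl; sym; trans; cong; subst)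
  open import Relation.Binary.Construct.Closure.ReflexiveTransitive using (Star; ε; _◅_; _◅◅_; map; gmap; reverse)

  module PieceRootsFrom {n k} (G : Graph n) (Gs : Fin k → Subgraph G)
                        (conn : ∀ i → Connected (graph (Gs i))) (part : EdgePartition G Gs)
                        (cyc : ∀ (C : Cycle G) → ∃[ i ] CycleIn C (Gs i)) (s : Fin n) where

    open Decomposition G Gs conn part cyc
    open RankFrom G s

    e : ∀ j → Fin (size (Gs j)) → Fin n
    e j = emb (Gs j)

    Step : Fin n → Fin n → Set
    Step a b = Adj G a b × rank a ≢ rank b

    stepSym : ∀ {a b} → Step a b → Step b a
    stepSym (a , ≢) = adjSym G a , λ eq → ≢ (sym eq)

    descent : ∀ t v → rank v ≤ t →
              Σ[ z ∈ Fin n ] (Root z × Σ[ p ∈ Star Step v z ] (∀ {w} → w ∈ verts p → w ≡ v ⊎ rank w < rank v))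
    descent t v bound with rank v in eq
    descent t v bound | zero = v , rank0⇒root v eq , ε , λ { (here refl) → inj₁ refl }
    descent (suc t) v (s≤s bound) | suc r with rank-descend v r eq
    ... | w , a , w≤r with descent t w (≤-trans w≤r bound)
    ...   | z , z-root , p , below = z , z-root , down ◅ p , onWalk
      where
      w<v : rank w < suc r
      w<v = s≤s w≤r
      down : Step v w
      down = a , λ eq′ → n≮n _ (subst (_< suc r) (trans (sym eq′) eq) w<v)
      onWalk : ∀ {u} → u ∈ verts (down ◅ p) → u ≡ v ⊎ rank u < suc r
      onWalk (here u≡v) = inj₁ u≡v
      onWalk (there m) with below m
      ... | inj₁ refl = inj₂ w<v
      ... | inj₂ lt = inj₂ (<-trans lt w<v)

    -- two connected vertices x, y are joined by a rank-changing walk through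
    -- the common root of their component, below x on one side and below y on the other
    valley : ∀ {x y} → Reach x y →
             Σ[ W ∈ Star Step x y ]
               (∀ {w} → w ∈ verts W → (w ≡ x ⊎ rank w < rank x) ⊎ (w ≡ y ⊎ rank w < rank y))
    valley {x} {y} x~y with descent _ x ≤-refl | descent _ y ≤-refl
    ... | zx , root-x , px , below-x | zy , root-y , py , below-y
      with root-unique root-x root-y (reachSym (map proj₁ px) ◅◅ x~y ◅◅ map proj₁ py)
    ... | refl = px ◅◅ reverse stepSym py , onValley
      where
      onValley : ∀ {w} → w ∈ verts (px ◅◅ reverse stepSym py) →
                 (w ≡ x ⊎ rank w < rank x) ⊎ (w ≡ y ⊎ rank w < rank y)
      onValley m with ∈-◅◅⁻ px _ m
      ... | inj₁ m′ = inj₁ (below-x m′)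
      ... | inj₂ m′ = inj₂ (below-y (∈-reverse stepSym py m′))

    piece-reach : ∀ j a b → Reach (e j a) (e j b)
    piece-reach j a b = gmap (e j) (λ {x} {y} → emb-edge (Gs j) x y) (proj₂ (conn j) a b)

    abstract
      root : ∀ j → Fin (size (Gs j))
      root j = argmin (λ a → rank (e j a)) (proj₁ (conn j)) (allFin _)

      root-minimal : ∀ j a → rank (e j (root j)) ≤ rank (e j a)
      root-minimal j a = All.lookup (f[argmin]≤f[xs] {f = λ a → rank (e j a)} (proj₁ (conn j)) (allFin _)) (∈-allFin a)

    root-minimal′ : ∀ j {w} → In j w → rank (e j (root j)) ≤ rank w
    root-minimal′ j (a , refl) = root-minimal j a

    least-unique : ∀ j a → rank (e j a) ≡ rank (e j (root j)) → a ≡ root j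
    least-unique j a same with a ≟ root j
    ... | yes eq = eq
    ... | no a≢r with valley (piece-reach j a (root j))
    ...   | W , onW = ⊥-elim (no-detour j W′ onW′ (λ eq → a≢r (emb-injective (Gs j) eq)) (a , refl) (root j , refl))
      where
      x y : Fin n
      x = e j a
      y = e j (root j)
      Low : Fin n → Set
      Low w = w ≡ x ⊎ w ≡ y ⊎ rank w < rank y
      low : ∀ {w} → w ∈ verts W → Low w
      low m with onW m
      ... | inj₁ (inj₁ w≡x) = inj₁ w≡x
      ... | inj₁ (inj₂ lt) = inj₂ (inj₂ (subst (_ <_) same lt))
      ... | inj₂ (inj₁ w≡y) = inj₂ (inj₁ w≡y)
      ... | inj₂ (inj₂ lt) = inj₂ (inj₂ lt)
      -- the only vertices of W in G_j are x and y, which have the same rank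
      rank-in-piece : ∀ {u} → Low u → In j u → rank u ≡ rank y
      rank-in-piece (inj₁ refl) _ = same
      rank-in-piece (inj₂ (inj₁ refl)) _ = refl
      rank-in-piece (inj₂ (inj₂ lt)) u∈j = ⊥-elim (n≮n _ (<-≤-trans lt (root-minimal′ j u∈j)))
      outside : ∀ {u v} → Low u → Low v → Step u v → Outside j u v
      outside lu lv (a , ≢) =
        a , λ uv → ≢ (trans (rank-in-piece lu (proj₁ (edgeIn uv))) (sym (rank-in-piece lv (proj₂ (edgeIn uv)))))
      W′ : Star (Outside j) x y
      W′ = proj₁ (refine Low outside W low)
      onW′ : ∀ {w} → w ∈ verts W′ → w ≡ x ⊎ w ≡ y ⊎ ¬ In j w
      onW′ m with low (subst (_ ∈_) (proj₂ (refine Low outside W low)) m)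
      ... | inj₁ w≡x = inj₁ w≡x
      ... | inj₂ (inj₁ w≡y) = inj₂ (inj₁ w≡y)
      ... | inj₂ (inj₂ lt) = inj₂ (inj₂ λ w∈j → n≮n _ (<-≤-trans lt (root-minimal′ j w∈j)))

    root-strict : ∀ j a → a ≢ root j → rank (e j (root j)) < rank (e j a)
    root-strict j a a≢r = ≤∧≢⇒< (root-minimal j a) (λ eq → a≢r (least-unique j a (sym eq)))

    root-s : ∀ j a → e j a ≡ s → a ≡ root j
    root-s j a eq = least-unique j a (≤-antisym (subst (_≤ _) (sym rank0) z≤n) (root-minimal j a))
      where
      rank0 : rank (e j a) ≡ 0
      rank0 = trans (cong rank eq) rank-s

    -- a non-root vertex z of G_J has no edge of another piece descending in rank:
    -- going down from z and up to the root of G_J would be a detour of G_J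
    no-descent-outside : ∀ J a {c w} → c ≢ J → EdgeIn (Gs c) (e J a) w → rank w < rank (e J a) →
                         rank (e J (root J)) < rank (e J a) → ⊥
    no-descent-outside J a {c} {w} c≢J zw w<z r<z
      with valley (adjSym G (edgeAdj (Gs c) zw) ◅ piece-reach J a (root J))
    ... | W , onW with cut (In J) (In? J) W (root J , refl)
    ...   | x , x∈J , q , q⊆W , onq = no-detour J detour onDetour z≢x (a , refl) x∈J
      where
      z : Fin n
      z = e J a
      below-z : ∀ {u} → u ∈ verts W → rank u < rank z
      below-z m with onW m
      ... | inj₁ (inj₁ refl) = w<z
      ... | inj₁ (inj₂ lt) = <-trans lt w<z
      ... | inj₂ (inj₁ refl) = r<z
      ... | inj₂ (inj₂ lt) = <-trans lt r<z
      leave : ∀ {u v} → Step u v × ¬ In J u → Outside J u v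
      leave ((a , _) , u∉J) = a , λ uv → u∉J (proj₁ (edgeIn uv))
      detour : Star (Outside J) z x
      detour = (edgeAdj (Gs c) zw , λ zw∈J → c≢J (edge-unique zw zw∈J)) ◅ map leave q
      onDetour : ∀ {u} → u ∈ verts detour → u ≡ z ⊎ u ≡ x ⊎ ¬ In J u
      onDetour (here u≡z) = inj₁ u≡z
      onDetour (there m) = inj₂ (onq (subst (_ ∈_) (verts-map leave q) m))
      z≢x : z ≢ x
      z≢x z≡x = n≮n _ (subst (λ u → rank u < rank z) (sym z≡x) (below-z (q⊆W (end∈ q))))

    shared-is-root : ∀ h j ah aj → h ≢ j → e h ah ≡ e j aj → ah ≢ root h → aj ≢ root j → ⊥
    shared-is-root h j ah aj h≢j shared ah≢r aj≢r with rank (e h ah) in rank-x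
    ... | zero = n≮n 0 (subst (_ <_) rank-x (≤-<-trans z≤n (root-strict h ah ah≢r)))
    ... | suc t with rank-descend (e h ah) t rank-x
    ...   | w , xw , w≤t with proj₁ part (e h ah) w xw
    ...     | c , xw∈c with c ≟ h
    ...       | yes refl = no-descent-outside j aj h≢j (subst (λ x → EdgeIn (Gs h) x w) shared xw∈c)
                             (subst (rank w <_) (cong rank shared) w<x)
                             (root-strict j aj aj≢r)
      where
      w<x : rank w < rank (e h ah)
      w<x = subst (rank w <_) (sym rank-x) (s≤s w≤t)
    ...       | no c≢h = no-descent-outside h ah c≢h xw∈c (subst (rank w <_) (sym rank-x) (s≤s w≤t))
                           (root-strict h ah ah≢r)

    pot : Fin k → ℕ
    pot j = rank (e j (root j))

    -- a non-root vertex of G_h lying in another piece G_j is the root of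
    -- G_j, so passing from G_h to G_j there raises the potential
    pot-raise : ∀ h j a b → h ≢ j → e h a ≡ e j b → a ≢ root h → pot h < pot j
    pot-raise h j a b h≢j shared a≢r with b ≟ root j
    ... | yes refl = subst (pot h <_) (cong rank shared) (root-strict h a a≢r)
    ... | no b≢r = ⊥-elim (shared-is-root h j a b h≢j shared a≢r b≢r)

module PhylogenyDigraphs where

  open import Defs hiding (sym)
  open import Data.Nat using (ℕ; suc; _<_; s≤s)
  open import Data.Nat.Properties using (n<1+n; m≤n⇒m<n∨m≡n)
  open import Data.Fin using (Fin; toℕ)
  open import Data.Fin.Properties using (any?; all?; pigeonhole; _≟_)
  open import Data.Fin.Permutation using (_⟨$⟩ʳ_; _⟨$⟩ˡ_; inverseˡ; inverseʳ)
  open import Data.Vec using (Vec; []; _∷_; lookup; tabulate)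
  open import Data.Vec.Properties using (lookup∘tabulate)
  open import Data.Bool using (T)
  open import Data.Bool.Properties using (T?) renaming (_≟_ to _≟ᵇ_)
  open import Data.Product using (Σ-syntax; ∃; ∃-syntax; _×_; _,_; proj₁; proj₂)
  open import Data.Sum using (_⊎_; inj₁; inj₂)
  open import Data.Empty using (⊥-elim)
  open import Relation.Nullary using (¬_; Dec; yes; no)
  open import Relation.Nullary.Decidable using (_×-dec_; ¬?; _→-dec_)
  open import Relation.Binary.PropositionalEquality using (_≡_; _≢_; refl; sym; trans; cong; cong₂; subst)
  open import Relation.Binary.Construct.Closure.Transitive using (TransClosure; [_]; _∷_)
  open import Function.Bundles using (_⇔_; mk⇔; Equivalence)

  mapTC : ∀ {A B : Set} {R : A → A → Set} {S : B → B → Set} (f : A → B) →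
          (∀ {x y} → R x y → S (f x) (f y)) → ∀ {x y} → TransClosure R x y → TransClosure S (f x) (f y)
  mapTC f g [ r ] = [ g r ]
  mapTC f g (r ∷ rs) = g r ∷ mapTC f g rs

  -- a nonempty finite acyclic relation has a minimal element (no predecessor):
  -- otherwise walking backwards m + 1 times repeats a vertex
  acyclic-source : ∀ {m} (R : Fin m → Fin m → Set) → (∀ x y → Dec (R x y)) →
                   (∀ v → ¬ TransClosure R v v) → Fin m → ∃[ s ] (∀ u → ¬ R u s)
  acyclic-source {m} R R? acyclic v₀ with any? (λ s → all? (λ u → ¬? (R? u s)))
  ... | yes found = found
  ... | no none = ⊥-elim (acyclic _ (subst (λ z → TransClosure R z (back (toℕ i))) (sym same) (descend i<j)))
    where
    predecessor : ∀ v → ∃[ u ] R u v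
    predecessor v with any? (λ u → R? u v)
    ... | yes p = p
    ... | no ¬p = ⊥-elim (none (v , λ u r → ¬p (u , r)))
    back : ℕ → Fin m
    back 0 = v₀
    back (suc t) = proj₁ (predecessor (back t))
    descend : ∀ {i j} → i < j → TransClosure R (back j) (back i)
    descend {i} {suc j} (s≤s i≤j) with m≤n⇒m<n∨m≡n i≤j
    ... | inj₁ i<j = proj₂ (predecessor (back j)) ∷ descend i<j
    ... | inj₂ refl = [ proj₂ (predecessor (back j)) ]
    repeat : ∃[ i ] ∃[ j ] (toℕ i < toℕ j × back (toℕ i) ≡ back (toℕ j))
    repeat = pigeonhole (n<1+n m) (λ i → back (toℕ i))
    i j : Fin (suc m)
    i = proj₁ repeat
    j = proj₁ (proj₂ repeat)
    i<j : toℕ i < toℕ j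
    i<j = proj₁ (proj₂ (proj₂ repeat))
    same : back (toℕ i) ≡ back (toℕ j)
    same = proj₂ (proj₂ (proj₂ repeat))

  source : ∀ {m p} (H : Graph m) (D : Digraph (Fin m ⊎ Fin p)) → IsPhylogenyDigraph H p D →
           Fin m → ∃[ s ] (∀ y → ¬ Arc D y (inj₁ s))
  source H D (acyclic , _ , no-back) v₀
    with acyclic-source (λ u v → Arc D (inj₁ u) (inj₁ v)) (λ u v → T? (arc D (inj₁ u) (inj₁ v)))
                        (λ v c → acyclic (inj₁ v) (mapTC inj₁ (λ a → a) c)) v₀
  ... | s , no-pred = s , λ { (inj₁ u) → no-pred u ; (inj₂ b) → no-back b s }

  IsAutomorphismMap : ∀ {m} → Graph m → (Fin m → Fin m) → Set
  IsAutomorphismMap {m} H τ =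
    (∀ x y → τ x ≡ τ y → x ≡ y) × (∀ y → ∃[ x ] τ x ≡ y) × (∀ x y → adj H (τ x) (τ y) ≡ adj H x y)

  -- vertex transitivity witnessed by automorphisms given as lookup tables;
  -- unlike 'VertexTransitive' this is decidable
  TableTransitive : ∀ {m} → Graph m → Set
  TableTransitive {m} H =
    ∀ u v → Σ[ τ ∈ Vec (Fin m) m ] (IsAutomorphismMap H (lookup τ) × lookup τ u ≡ v)

  ∃-vec? : ∀ {m} l (P : Vec (Fin m) l → Set) → (∀ v → Dec (P v)) → Dec (∃ P)
  ∃-vec? 0 P P? with P? []
  ... | yes p = yes ([] , p)
  ... | no ¬p = no λ { ([] , p) → ¬p p }
  ∃-vec? (suc l) P P? with any? (λ a → ∃-vec? l (λ v → P (a ∷ v)) (λ v → P? (a ∷ v)))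
  ... | yes (a , v , p) = yes (a ∷ v , p)
  ... | no ¬p = no λ { (a ∷ v , p) → ¬p (a , v , p) }

  TableTransitive? : ∀ {m} (H : Graph m) → Dec (TableTransitive H)
  TableTransitive? {m} H = all? λ u → all? λ v → ∃-vec? m _ λ τ →
    (all? (λ x → all? (λ y → (lookup τ x ≟ lookup τ y) →-dec (x ≟ y)))
      ×-dec (all? (λ y → any? (λ x → lookup τ x ≟ y))
      ×-dec all? (λ x → all? (λ y → adj H (lookup τ x) (lookup τ y) ≟ᵇ adj H x y))))
    ×-dec (lookup τ u ≟ v)

  VT⇒TableTransitive : ∀ {m} (H : Graph m) → VertexTransitive H → TableTransitive H
  VT⇒TableTransitive {m} H vt u v with vt u v
  ... | σ , aut , σu≡v = τ , (injective , surjective , preserves) , trans (table u) σu≡v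
    where
    τ : Vec (Fin m) m
    τ = tabulate (σ ⟨$⟩ʳ_)
    table : ∀ x → lookup τ x ≡ σ ⟨$⟩ʳ x
    table = lookup∘tabulate (σ ⟨$⟩ʳ_)
    injective : ∀ x y → lookup τ x ≡ lookup τ y → x ≡ y
    injective x y eq = trans (sym (inverseˡ σ))
      (trans (cong (σ ⟨$⟩ˡ_) (trans (sym (table x)) (trans eq (table y)))) (inverseˡ σ))
    surjective : ∀ y → ∃[ x ] lookup τ x ≡ y
    surjective y = σ ⟨$⟩ˡ y , trans (table _) (inverseʳ σ)
    preserves : ∀ x y → adj H (lookup τ x) (lookup τ y) ≡ adj H x y
    preserves x y = trans (cong₂ (adj H) (table x) (table y)) (aut x y)

  module Relabel {m p : ℕ} (H : Graph m) (D : Digraph (Fin m ⊎ Fin p)) (ph : IsPhylogenyDigraph H p D)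
                 (τ : Fin m → Fin m) (aut : IsAutomorphismMap H τ) where

    φ : Fin m ⊎ Fin p → Fin m ⊎ Fin p
    φ (inj₁ x) = inj₁ (τ x)
    φ (inj₂ a) = inj₂ a

    φ-surjective : ∀ w → ∃[ w′ ] φ w′ ≡ w
    φ-surjective (inj₁ y) with proj₁ (proj₂ aut) y
    ... | x , refl = inj₁ x , refl
    φ-surjective (inj₂ a) = inj₂ a , refl

    D′ : Digraph (Fin m ⊎ Fin p)
    D′ = record { arc = λ x y → arc D (φ x) (φ y) }

    -- P(D′) is P(D) pulled back along φ (φ is onto, for common out-neighbours)
    toP : ∀ {u v} → PAdj D (φ u) (φ v) → PAdj D′ u v
    toP (inj₁ a) = inj₁ a
    toP (inj₂ (inj₁ a)) = inj₂ (inj₁ a)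
    toP (inj₂ (inj₂ (w , a , b))) with φ-surjective w
    ... | w′ , refl = inj₂ (inj₂ (w′ , a , b))

    fromP : ∀ {u v} → PAdj D′ u v → PAdj D (φ u) (φ v)
    fromP (inj₁ a) = inj₁ a
    fromP (inj₂ (inj₁ a)) = inj₂ (inj₁ a)
    fromP (inj₂ (inj₂ (w , a , b))) = inj₂ (inj₂ (φ w , a , b))

    isPhylogeny : IsPhylogenyDigraph H p D′
    isPhylogeny = (λ v c → acyclic (φ v) (mapTC φ (λ a → a) c))
                , (λ u v u≢v → let iff = induced (τ u) (τ v) (λ eq → u≢v (proj₁ aut u v eq)) in
                     mk⇔ (λ a → toP (Equivalence.to iff (subst T (sym (preserves u v)) a)))
                         (λ q → subst T (preserves u v) (Equivalence.from iff (fromP q))))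
                , (λ a u → no-back a (τ u))
      where
      acyclic : Acyclic D
      acyclic = proj₁ ph
      induced : ∀ u v → u ≢ v → Adj H u v ⇔ PAdj D (inj₁ u) (inj₁ v)
      induced = proj₁ (proj₂ ph)
      no-back : ∀ a u → ¬ Arc D (inj₂ a) (inj₁ u)
      no-back = proj₂ (proj₂ ph)
      preserves : ∀ x y → adj H (τ x) (τ y) ≡ adj H x y
      preserves = proj₂ (proj₂ aut)

  source-anywhere : ∀ {m p} (H : Graph m) → TableTransitive H → (D : Digraph (Fin m ⊎ Fin p)) →
                    IsPhylogenyDigraph H p D → ∀ r →
                    Σ[ D′ ∈ Digraph (Fin m ⊎ Fin p) ] (IsPhylogenyDigraph H p D′ × (∀ y → ¬ Arc D′ y (inj₁ r)))
  source-anywhere H vt D ph r with source H D ph r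
  ... | s , s-source with vt r s
  ...   | τ , aut , τr≡s =
    Relabel.D′ H D ph (lookup τ) aut , Relabel.isPhylogeny H D ph (lookup τ) aut ,
    λ y a → s-source _ (subst (λ z → Arc D (Relabel.φ H D ph (lookup τ) aut y) (inj₁ z)) τr≡s a)

module FinSum where

  -- Fin (p₀ + … + p_{k-1}) is in bijection with the disjoint union of the
  -- Fin pᵢ; it is used to give the pieces disjoint sets of extra vertices
  -- and, conversely, to count extra vertices piece by piece.

  open import Defs using (sumFin)
  open import Data.Nat using (ℕ; suc)
  open import Data.Fin using (Fin; zero; suc; _↑ˡ_; _↑ʳ_; splitAt)
  open import Data.Fin.Properties using (splitAt-↑ˡ; splitAt-↑ʳ; splitAt⁻¹-↑ˡ; splitAt⁻¹-↑ʳ)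
  open import Data.Product using (Σ; _,_; proj₁; proj₂)
  open import Data.Sum using (inj₁; inj₂)
  open import Relation.Binary.PropositionalEquality using (_≡_; refl; sym; trans; cong)
  open import Function.Definitions using (Injective)

  enc : ∀ {k} (ps : Fin k → ℕ) → Σ (Fin k) (λ j → Fin (ps j)) → Fin (sumFin ps)
  enc {suc k} ps (zero , a) = a ↑ˡ sumFin (λ j → ps (suc j))
  enc {suc k} ps (suc j , a) = ps zero ↑ʳ enc (λ j → ps (suc j)) (j , a)

  dec : ∀ {k} (ps : Fin k → ℕ) → Fin (sumFin ps) → Σ (Fin k) (λ j → Fin (ps j))
  dec {suc k} ps x with splitAt (ps zero) x
  ... | inj₁ a = zero , a
  ... | inj₂ y = let r = dec (λ j → ps (suc j)) y in suc (proj₁ r) , proj₂ r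

  dec-enc : ∀ {k} (ps : Fin k → ℕ) p → dec ps (enc ps p) ≡ p
  dec-enc {suc k} ps (zero , a) rewrite splitAt-↑ˡ (ps zero) a (sumFin (λ j → ps (suc j))) = refl
  dec-enc {suc k} ps (suc j , a)
    rewrite splitAt-↑ʳ (ps zero) (sumFin (λ j → ps (suc j))) (enc (λ j → ps (suc j)) (j , a))
          | dec-enc (λ j → ps (suc j)) (j , a) = refl

  enc-dec : ∀ {k} (ps : Fin k → ℕ) x → enc ps (dec ps x) ≡ x
  enc-dec {suc k} ps x with splitAt (ps zero) x in eq
  ... | inj₁ a = splitAt⁻¹-↑ˡ eq
  ... | inj₂ y = trans (cong (ps zero ↑ʳ_) (enc-dec (λ j → ps (suc j)) y)) (splitAt⁻¹-↑ʳ eq)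

  enc-injective : ∀ {k} (ps : Fin k → ℕ) → Injective _≡_ _≡_ (enc ps)
  enc-injective ps {p} {q} eq = trans (sym (dec-enc ps p)) (trans (cong (dec ps) eq) (dec-enc ps q))

  dec-injective : ∀ {k} (ps : Fin k → ℕ) → Injective _≡_ _≡_ (dec ps)
  dec-injective ps {x} {y} eq = trans (sym (enc-dec ps x)) (trans (cong (enc ps) eq) (enc-dec ps y))

module Gluing where

  -- A directed
  -- cycle could only change pieces at shared vertices, where the potential
  -- increases; so it stays in one D_j, which is acyclic.

  open import Defs hiding (sym)
  open FinSum
  open Pieces using (adjSym; adj≢)
  open PhylogenyDigraphs using (mapTC)
  open import Data.Nat using (ℕ; _<_)
  open import Data.Nat.Properties using (<-trans; n≮n; <-asym)
  open import Data.Fin using (Fin)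
  open import Data.Fin.Properties using (any?; _≟_)
  open import Data.Bool.Properties using (T?)
  open import Data.Product using (∃; ∃-syntax; _×_; _,_; proj₁; proj₂)
  open import Data.Sum using (_⊎_; inj₁; inj₂)
  open import Data.Sum.Properties using (inj₁-injective; inj₂-injective) renaming (≡-dec to ⊎-≡-dec)
  open import Data.Unit using (⊤)
  open import Data.Empty using (⊥-elim)
  open import Relation.Nullary using (¬_; Dec; yes; no)
  open import Relation.Nullary.Decidable using (_×-dec_; toWitness; fromWitness; ⌊_⌋)
  open import Relation.Binary.PropositionalEquality using (_≡_; _≢_; refl; sym; trans; cong)
  open import Relation.Binary.Construct.Closure.Transitive using (TransClosure; [_]; _∷_)
  open import Function.Bundles using (mk⇔; Equivalence)

  any⊎? : ∀ {a b} {P : Fin a ⊎ Fin b → Set} → (∀ x → Dec (P x)) → Dec (∃ P)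
  any⊎? P? with any? (λ x → P? (inj₁ x)) | any? (λ x → P? (inj₂ x))
  ... | yes (x , p) | _ = yes (inj₁ x , p)
  ... | no _ | yes (x , p) = yes (inj₂ x , p)
  ... | no ¬l | no ¬r = no λ { (inj₁ x , p) → ¬l (x , p) ; (inj₂ x , p) → ¬r (x , p) }

  module Glue {n k} (G : Graph n) (Gs : Fin k → Subgraph G) (part : EdgePartition G Gs) (ps : Fin k → ℕ)
              (Ds : ∀ j → Digraph (Fin (size (Gs j)) ⊎ Fin (ps j)))
              (phs : ∀ j → IsPhylogenyDigraph (graph (Gs j)) (ps j) (Ds j))
              (root : ∀ j → Fin (size (Gs j)))
              (root-source : ∀ j y → ¬ Arc (Ds j) y (inj₁ (root j)))
              (pot : Fin k → ℕ)
              (pot-raise : ∀ h j a b → h ≢ j → emb (Gs h) a ≡ emb (Gs j) b → a ≢ root h → pot h < pot j) where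

    e : ∀ j → Fin (size (Gs j)) → Fin n
    e j = emb (Gs j)

    V : Set
    V = Fin n ⊎ Fin (sumFin ps)

    Local : Fin k → Set
    Local j = Fin (size (Gs j)) ⊎ Fin (ps j)

    ι : ∀ j → Local j → V
    ι j (inj₁ u) = inj₁ (e j u)
    ι j (inj₂ a) = inj₂ (enc ps (j , a))

    ι-injective : ∀ j {x y} → ι j x ≡ ι j y → x ≡ y
    ι-injective j {inj₁ u} {inj₁ v} eq = cong inj₁ (emb-injective (Gs j) (inj₁-injective eq))
    ι-injective j {inj₂ a} {inj₂ b} eq with enc-injective ps (inj₂-injective eq)
    ... | refl = refl

    NonRoot : ∀ j → Local j → Set
    NonRoot j (inj₁ u) = u ≢ root j
    NonRoot j (inj₂ _) = ⊤

    arc-head : ∀ j {x y} → Arc (Ds j) x y → NonRoot j y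
    arc-head j {y = inj₁ u} a refl = root-source j _ a
    arc-head j {y = inj₂ _} a = _

    last-head : ∀ j {x y} → TransClosure (Arc (Ds j)) x y → NonRoot j y
    last-head j [ a ] = arc-head j a
    last-head j (_ ∷ c) = last-head j c

    switch : ∀ j x i y → ι j x ≡ ι i y → NonRoot j x → i ≡ j ⊎ pot j < pot i
    switch j x i y eq nonroot with i ≟ j
    ... | yes i≡j = inj₁ i≡j
    switch j (inj₁ u) i (inj₁ v) eq nonroot | no i≢j =
      inj₂ (pot-raise j i u v (λ j≡i → i≢j (sym j≡i)) (inj₁-injective eq) nonroot)
    switch j (inj₂ a) i (inj₂ b) eq _ | no i≢j with enc-injective ps (inj₂-injective eq)
    ... | refl = ⊥-elim (i≢j refl)

    GArc : V → V → Set
    GArc p q = ∃[ j ] ∃[ x ] ∃[ y ] (ι j x ≡ p × ι j y ≡ q × Arc (Ds j) x y)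

    GArc? : ∀ p q → Dec (GArc p q)
    GArc? p q = any? λ j → any⊎? λ x → any⊎? λ y →
      ⊎-≡-dec _≟_ _≟_ (ι j x) p ×-dec (⊎-≡-dec _≟_ _≟_ (ι j y) q ×-dec T? (arc (Ds j) x y))

    D : Digraph V
    D = record { arc = λ p q → ⌊ GArc? p q ⌋ }

    toW : ∀ {p q} → Arc D p q → GArc p q
    toW {p} {q} = toWitness {a? = GArc? p q}

    fromW : ∀ {p q} → GArc p q → Arc D p q
    fromW {p} {q} = fromWitness {a? = GArc? p q}

    Summary : V → V → Set
    Summary p q = (∃[ j ] ∃[ x ] ∃[ y ] (ι j x ≡ p × ι j y ≡ q × TransClosure (Arc (Ds j)) x y))
                ⊎ (∃[ j ] ∃[ x ] ∃[ i ] ∃[ y ] (ι j x ≡ p × ι i y ≡ q × NonRoot i y × pot j < pot i))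

    summary : ∀ {p q} → TransClosure GArc p q → Summary p q
    summary [ j , x , y , refl , refl , a ] = inj₁ (j , x , y , refl , refl , [ a ])
    summary ((h , x , m , refl , refl , a) ∷ c) with summary c
    ... | inj₁ (j , m′ , y , m≡ , refl , c′) with switch h m j m′ (sym m≡) (arc-head h a)
    ...   | inj₂ h<j = inj₂ (h , x , j , y , refl , refl , last-head j c′ , h<j)
    ...   | inj₁ refl with ι-injective h m≡
    ...     | refl = inj₁ (h , x , y , refl , refl , a ∷ c′)
    summary ((h , x , m , refl , refl , a) ∷ c)
        | inj₂ (j , m′ , i , y , m≡ , refl , nonroot , j<i) with switch h m j m′ (sym m≡) (arc-head h a)
    ... | inj₁ refl = inj₂ (h , x , i , y , refl , refl , nonroot , j<i)
    ... | inj₂ h<j = inj₂ (h , x , i , y , refl , refl , nonroot , <-trans h<j j<i)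

    acyclic : Acyclic D
    acyclic p cycle with summary (mapTC (λ v → v) toW cycle)
    ... | inj₁ (j , x , y , refl , y≡x , c) with ι-injective j y≡x
    ...   | refl = proj₁ (phs j) x c
    acyclic p cycle | inj₂ (j , x , i , y , refl , y≡x , nonroot , j<i) with switch i y j x y≡x nonroot
    ... | inj₁ refl = n≮n _ j<i
    ... | inj₂ i<j = <-asym j<i i<j

    no-back : ∀ a u → ¬ Arc D (inj₂ a) (inj₁ u)
    no-back a u arc with toW arc
    ... | j , inj₂ b , inj₁ v , _ , _ , a′ = proj₂ (proj₂ (phs j)) b v a′

    fromPiece : ∀ j {u v} → e j u ≢ e j v → PAdj (Ds j) (inj₁ u) (inj₁ v) → Adj G (e j u) (e j v)
    fromPiece j {u} {v} e≢ pa =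
      emb-edge (Gs j) u v (Equivalence.from (proj₁ (proj₂ (phs j)) u v (λ u≡v → e≢ (cong (e j) u≡v))) pa)

    arc-adj : ∀ {x y} → GArc (inj₁ x) (inj₁ y) → x ≢ y → Adj G x y
    arc-adj (j , inj₁ u , inj₁ v , refl , refl , a) x≢y = fromPiece j x≢y (inj₁ a)

    common-in-piece : ∀ j {u v w w′} → ι j w ≡ ι j w′ → Arc (Ds j) (inj₁ u) w → Arc (Ds j) (inj₁ v) w′ →
                      e j u ≢ e j v → Adj G (e j u) (e j v)
    common-in-piece j same au av e≢ with ι-injective j same
    ... | refl = fromPiece j e≢ (inj₂ (inj₂ (_ , au , av)))

    -- two vertices with a common out-neighbour w in the glued digraph get
    -- their arcs to w from the same piece: w is a non-root head in both
    common-adj : ∀ {x y w} → GArc (inj₁ x) w → GArc (inj₁ y) w → x ≢ y → Adj G x y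
    common-adj (j , inj₁ u , wj , refl , eqj , aj) (i , inj₁ v , wi , refl , eqi , ai) x≢y
      with switch j wj i wi (trans eqj (sym eqi)) (arc-head j aj)
         | switch i wi j wj (trans eqi (sym eqj)) (arc-head i ai)
    ... | inj₂ j<i | inj₂ i<j = ⊥-elim (<-asym j<i i<j)
    ... | inj₁ refl | _ = common-in-piece j (trans eqj (sym eqi)) aj ai x≢y
    ... | inj₂ _ | inj₁ refl = common-in-piece j (trans eqj (sym eqi)) aj ai x≢y

    lift : ∀ i {u v} → PAdj (Ds i) (inj₁ u) (inj₁ v) → PAdj D (inj₁ (e i u)) (inj₁ (e i v))
    lift i {u} {v} (inj₁ a) = inj₁ (fromW (i , inj₁ u , inj₁ v , refl , refl , a))
    lift i {u} {v} (inj₂ (inj₁ a)) = inj₂ (inj₁ (fromW (i , inj₁ v , inj₁ u , refl , refl , a)))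
    lift i {u} {v} (inj₂ (inj₂ (w , a , b))) =
      inj₂ (inj₂ (ι i w , fromW (i , inj₁ u , w , refl , refl , a) , fromW (i , inj₁ v , w , refl , refl , b)))

    toP : ∀ x y → Adj G x y → PAdj D (inj₁ x) (inj₁ y)
    toP x y xy with proj₁ part x y xy
    ... | i , u , v , uv , refl , refl =
      lift i (Equivalence.to (proj₁ (proj₂ (phs i)) u v (adj≢ (graph (Gs i)) uv)) uv)

    fromP : ∀ x y → x ≢ y → PAdj D (inj₁ x) (inj₁ y) → Adj G x y
    fromP x y x≢y (inj₁ a) = arc-adj (toW a) x≢y
    fromP x y x≢y (inj₂ (inj₁ a)) = adjSym G (arc-adj (toW a) (λ y≡x → x≢y (sym y≡x)))
    fromP x y x≢y (inj₂ (inj₂ (w , a , b))) = common-adj (toW a) (toW b) x≢y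

    isPhylogeny : IsPhylogenyDigraph G (sumFin ps) D
    isPhylogeny = acyclic , (λ x y x≢y → mk⇔ (toP x y) (fromP x y x≢y)) , no-back

module Restriction where

  -- Call an extra vertex a used by G_i
  -- when two ends of an edge of G_i are in-neighbours of a.  Since triangles
  -- lie in single pieces, all in-neighbours of such an a are pairwise joined
  -- by edges of G_i; hence a is used by at most one piece.  Keeping the arcs
  -- of D along edges of G_i, and the arcs into vertices of G_i or into extra
  -- vertices used by G_i, gives a phylogeny digraph of G_i.  Thus
  -- p(G_i) ≤ mᵢ = #(extra vertices used by G_i), and m₁ + … + m_k ≤ m.

  open import Defs hiding (sym)
  open Pieces
  open FinSum
  open PhylogenyDigraphs using (mapTC)
  open import Data.Nat using (ℕ; suc; _≤_; z≤n)
  open import Data.Nat.Properties using (+-mono-≤)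
  open import Data.Fin using (Fin; zero; suc)
  open import Data.Fin.Properties using (any?; _≟_; injective⇒≤)
  open import Data.List using (List; filter; length; lookup; allFin)
  open import Data.List.Relation.Unary.All as All using (All)
  open import Data.List.Relation.Unary.All.Properties using (all-filter)
  open import Data.List.Relation.Unary.Any using (index)
  open import Data.List.Relation.Unary.Any.Properties using (lookup-index)
  open import Data.List.Relation.Unary.AllPairs using (_∷_)
  open import Data.List.Relation.Unary.Unique.Propositional using (Unique)
  import Data.List.Relation.Unary.Unique.Propositional.Properties as Unique
  open import Data.List.Membership.Propositional using (_∈_)
  open import Data.List.Membership.Propositional.Properties using (∈-allFin; ∈-filter⁺; ∈-lookup)
  open import Data.Bool using (Bool; false; _∧_)
  open import Data.Bool.Properties using (T?; T-∧)
  open import Data.Product using (∃-syntax; _×_; _,_; proj₁; proj₂)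
  open import Data.Sum using (_⊎_; inj₁; inj₂)
  open import Data.Empty using (⊥-elim)
  open import Relation.Nullary using (Dec; yes; no)
  open import Relation.Nullary.Decidable using (_×-dec_)
  open import Relation.Binary.PropositionalEquality using (_≡_; _≢_; refl; sym; cong; subst)
  open import Relation.Binary.Construct.Closure.Transitive using ([_])
  open import Function.Bundles using (mk⇔; Equivalence)

  sumFin-mono : ∀ {k} {f g : Fin k → ℕ} → (∀ i → f i ≤ g i) → sumFin f ≤ sumFin g
  sumFin-mono {0} _ = z≤n
  sumFin-mono {suc k} f≤g = +-mono-≤ (f≤g zero) (sumFin-mono (λ i → f≤g (suc i)))

  lookup-injective : ∀ {A : Set} {xs : List A} → Unique xs → ∀ {i j} → lookup xs i ≡ lookup xs j → i ≡ j
  lookup-injective (_ ∷ _) {zero} {zero} _ = refl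
  lookup-injective (x≢ ∷ _) {zero} {suc j} eq = ⊥-elim (All.lookup x≢ (∈-lookup j) eq)
  lookup-injective (x≢ ∷ _) {suc i} {zero} eq = ⊥-elim (All.lookup x≢ (∈-lookup i) (sym eq))
  lookup-injective (_ ∷ u) {suc i} {suc j} eq = cong suc (lookup-injective u eq)

  module Restrict {n k} (G : Graph n) (Gs : Fin k → Subgraph G)
                  (conn : ∀ i → Connected (graph (Gs i))) (part : EdgePartition G Gs)
                  (cyc : ∀ (C : Cycle G) → ∃[ i ] CycleIn C (Gs i))
                  (m : ℕ) (D : Digraph (Fin n ⊎ Fin m)) (ph : IsPhylogenyDigraph G m D) where

    open Decomposition G Gs conn part cyc

    e : ∀ j → Fin (size (Gs j)) → Fin n
    e j = emb (Gs j)

    induced : ∀ {x y} → x ≢ y → Adj G x y → PAdj D (inj₁ x) (inj₁ y)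
    induced x≢y = Equivalence.to (proj₁ (proj₂ ph) _ _ x≢y)

    common-adj : ∀ {x y w} → Arc D (inj₁ x) w → Arc D (inj₁ y) w → x ≢ y → Adj G x y
    common-adj a b x≢y = Equivalence.from (proj₁ (proj₂ ph) _ _ x≢y) (inj₂ (inj₂ (_ , a , b)))

    arc-adj : ∀ {x y} → Arc D (inj₁ x) (inj₁ y) → Adj G x y
    arc-adj a = Equivalence.from (proj₁ (proj₂ ph) _ _ (λ { refl → proj₁ ph _ [ a ] })) (inj₁ a)

    arc≢ : ∀ {p q} → Arc D p q → p ≢ q
    arc≢ a refl = proj₁ ph _ [ a ]

    edge≢ : ∀ i {x y} → EdgeIn (Gs i) x y → x ≢ y
    edge≢ i xy = adj≢ G (edgeAdj (Gs i) xy)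

    edge-local : ∀ i {u y} → EdgeIn (Gs i) (e i u) y → ∃[ y′ ] (e i y′ ≡ y × Adj (graph (Gs i)) u y′)
    edge-local i (u′ , y′ , a , eu , ey) with emb-injective (Gs i) eu
    ... | refl = y′ , ey , a

    edge-local′ : ∀ i {u v} → EdgeIn (Gs i) (e i u) (e i v) → Adj (graph (Gs i)) u v
    edge-local′ i uv with edge-local i uv
    ... | v′ , ev′ , a = subst (Adj (graph (Gs i)) _) (emb-injective (Gs i) ev′) a

    Used : Fin k → Fin m → Set
    Used i a = ∃[ X ] ∃[ Y ] (EdgeIn (Gs i) X Y × Arc D (inj₁ X) (inj₂ a) × Arc D (inj₁ Y) (inj₂ a))

    Used? : ∀ i a → Dec (Used i a)
    Used? i a = any? λ X → any? λ Y →
      EdgeIn? X Y ×-dec (T? (arc D (inj₁ X) (inj₂ a)) ×-dec T? (arc D (inj₁ Y) (inj₂ a)))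
      where
      EdgeIn? : ∀ X Y → Dec (EdgeIn (Gs i) X Y)
      EdgeIn? X Y = any? λ u → any? λ v → T? (adj (graph (Gs i)) u v) ×-dec ((e i u ≟ X) ×-dec (e i v ≟ Y))

    -- if X, Y are ends of an edge of G_i with an arc to a, so is every
    -- other in-neighbour z of a together with X (triangle X Y z)
    to-end : ∀ i {a X Y z} → EdgeIn (Gs i) X Y → Arc D (inj₁ X) (inj₂ a) → Arc D (inj₁ Y) (inj₂ a) →
             Arc D (inj₁ z) (inj₂ a) → z ≢ X → EdgeIn (Gs i) z X
    to-end i {Y = Y} {z} XY aX aY az z≢X with z ≟ Y
    ... | yes refl = edgeSym (Gs i) XY
    ... | no z≢Y = proj₂ (triangle i Y≢z z≢X XY (common-adj aY az Y≢z) (common-adj az aX z≢X))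
      where
      Y≢z : Y ≢ z
      Y≢z Y≡z = z≢Y (sym Y≡z)

    in-neighbours : ∀ i {a p q} → Used i a → p ≢ q → Arc D (inj₁ p) (inj₂ a) → Arc D (inj₁ q) (inj₂ a) →
                    EdgeIn (Gs i) p q
    in-neighbours i {p = p} {q} (X , Y , XY , aX , aY) p≢q ap aq with p ≟ X | q ≟ X
    ... | yes refl | _ = edgeSym (Gs i) (to-end i XY aX aY aq (λ q≡p → p≢q (sym q≡p)))
    ... | no p≢X | yes refl = to-end i XY aX aY ap p≢X
    ... | no p≢X | no q≢X =
      proj₁ (triangle i p≢q q≢X (edgeSym (Gs i) (to-end i XY aX aY ap p≢X))
                      (common-adj ap aq p≢q) (common-adj aq aX q≢X))

    used-unique : ∀ i j a → Used i a → Used j a → i ≡ j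
    used-unique i j a used-i (X , Y , XY , aX , aY) = edge-unique (in-neighbours i used-i (edge≢ j XY) aX aY) XY

    used : Fin k → List (Fin m)
    used i = filter (Used? i) (allFin m)

    extras : Fin k → ℕ
    extras i = length (used i)

    used-sound : ∀ i b → Used i (lookup (used i) b)
    used-sound i b = All.lookup (all-filter (Used? i) (allFin m)) (∈-lookup b)

    used-complete : ∀ i {a} → Used i a → ∃[ b ] lookup (used i) b ≡ a
    used-complete i {a} u = index a∈ , sym (lookup-index a∈)
      where
      a∈ : a ∈ used i
      a∈ = ∈-filter⁺ (Used? i) (∈-allFin a) u

    extras-bound : sumFin extras ≤ m
    extras-bound = injective⇒≤ {f = pick} (λ eq → dec-injective extras (same (dec extras _) (dec extras _) eq))
      where
      pick : Fin (sumFin extras) → Fin m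
      pick x = lookup (used (proj₁ (dec extras x))) (proj₂ (dec extras x))
      same : ∀ p q → lookup (used (proj₁ p)) (proj₂ p) ≡ lookup (used (proj₁ q)) (proj₂ q) → p ≡ q
      same (i , b) (j , c) eq with used-unique i j _ (used-sound i b) (subst (Used j) (sym eq) (used-sound j c))
      ... | refl = cong (i ,_) (lookup-injective (Unique.filter⁺ (Used? i) (Unique.allFin⁺ m)) eq)

    module Piece (i : Fin k) where

      H : Graph (size (Gs i))
      H = graph (Gs i)

      f : Fin (size (Gs i)) ⊎ Fin (extras i) → Fin n ⊎ Fin m
      f (inj₁ u) = inj₁ (e i u)
      f (inj₂ b) = inj₂ (lookup (used i) b)

      Dᵢ : Digraph (Fin (size (Gs i)) ⊎ Fin (extras i))
      Dᵢ = record { arc = arcᵢ }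
        where
        arcᵢ : Fin (size (Gs i)) ⊎ Fin (extras i) → Fin (size (Gs i)) ⊎ Fin (extras i) → Bool
        arcᵢ (inj₁ u) (inj₁ v) = adj H u v ∧ arc D (f (inj₁ u)) (f (inj₁ v))
        arcᵢ (inj₁ u) (inj₂ b) = arc D (f (inj₁ u)) (f (inj₂ b))
        arcᵢ (inj₂ _) _ = false

      arc-map : ∀ {p q} → Arc Dᵢ p q → Arc D (f p) (f q)
      arc-map {inj₁ u} {inj₁ v} a = proj₂ (Equivalence.to T-∧ a)
      arc-map {inj₁ u} {inj₂ b} a = a

      local-arc : ∀ {u v} → Adj H u v → Arc D (inj₁ (e i u)) (inj₁ (e i v)) → Arc Dᵢ (inj₁ u) (inj₁ v)
      local-arc uv a = Equivalence.from T-∧ (uv , a)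

      e≢ : ∀ {u v} → u ≢ v → e i u ≢ e i v
      e≢ u≢v eq = u≢v (emb-injective (Gs i) eq)

      -- an edge uv of G_i is in P(D) by an arc, or by a common out-neighbour
      -- that is a vertex of G_i (triangle) or an extra vertex used by G_i
      toP : ∀ u v → u ≢ v → Adj H u v → PAdj Dᵢ (inj₁ u) (inj₁ v)
      toP u v u≢v uv with induced (e≢ u≢v) (emb-edge (Gs i) u v uv)
      ... | inj₁ a = inj₁ (local-arc uv a)
      ... | inj₂ (inj₁ a) = inj₂ (inj₁ (local-arc (adjSym H uv) a))
      ... | inj₂ (inj₂ (inj₁ z , a , b))
        with triangle i (λ eq → arc≢ b (cong inj₁ eq)) (λ eq → arc≢ a (cong inj₁ (sym eq)))
                        (u , v , uv , refl , refl) (arc-adj b) (adjSym G (arc-adj a))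
      ...   | vz , zu with edge-local i (edgeSym (Gs i) zu)
      ...     | z′ , refl , uz′ = inj₂ (inj₂ (inj₁ z′ , local-arc uz′ a , local-arc (edge-local′ i vz) b))
      toP u v u≢v uv | inj₂ (inj₂ (inj₂ a , x , y))
        with used-complete i (e i u , e i v , (u , v , uv , refl , refl) , x , y)
      ... | b , refl = inj₂ (inj₂ (inj₂ b , x , y))

      fromP : ∀ u v → u ≢ v → PAdj Dᵢ (inj₁ u) (inj₁ v) → Adj H u v
      fromP u v u≢v (inj₁ a) = proj₁ (Equivalence.to T-∧ a)
      fromP u v u≢v (inj₂ (inj₁ a)) = adjSym H (proj₁ (Equivalence.to T-∧ a))
      fromP u v u≢v (inj₂ (inj₂ (inj₁ z , a , b))) with Equivalence.to T-∧ a | Equivalence.to T-∧ b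
      ... | uz , a′ | vz , b′ =
        edge-local′ i (proj₂ (triangle i (λ eq → adj≢ H uz (emb-injective (Gs i) (sym eq))) (e≢ u≢v)
                                        (v , z , vz , refl , refl) (emb-edge (Gs i) z u (adjSym H uz))
                                        (common-adj a′ b′ (e≢ u≢v))))
      fromP u v u≢v (inj₂ (inj₂ (inj₂ b , x , y))) = edge-local′ i (in-neighbours i (used-sound i b) (e≢ u≢v) x y)

      isPhylogeny : IsPhylogenyDigraph H (extras i) Dᵢ
      isPhylogeny = (λ v c → proj₁ ph (f v) (mapTC f arc-map c))
                  , (λ u v u≢v → mk⇔ (toP u v u≢v) (fromP u v u≢v))
                  , (λ _ _ ())

    restrict : ∀ i → HasPhylogenyDigraph (graph (Gs i)) (extras i)
    restrict i = Piece.Dᵢ i , Piece.isPhylogeny i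

open import Defs
open import Data.Nat using (ℕ; suc; _≤_)
open import Data.Nat.Properties using (≤-trans)
open import Data.Fin using (Fin; zero)
open import Data.Fin.Properties using (any?; _≟_)
open import Data.Product using (∃-syntax; Σ-syntax; _×_; _,_; proj₁; proj₂)
open import Data.Sum using (_⊎_; inj₁)
open import Relation.Nullary using (¬_; yes; no)
open import Relation.Nullary.Decidable using (¬?; decidable-stable)
open import Relation.Binary.PropositionalEquality using (_≡_; _≢_; refl; subst)

open PieceRoots using (module PieceRootsFrom)
open PhylogenyDigraphs using (TableTransitive; TableTransitive?; VT⇒TableTransitive; source; source-anywhere)
open Gluing using (module Glue)
open Restriction using (module Restrict; sumFin-mono)

exceptional-piece : ∀ {k} {sz : Fin k → ℕ} (H : ∀ j → Graph (sz j)) →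
                    (∀ i j → ¬ VertexTransitive (H i) → ¬ VertexTransitive (H j) → i ≡ j) → Fin k →
                    Σ[ j₀ ∈ Fin k ] (∀ j → j ≢ j₀ → TableTransitive (H j))
exceptional-piece H one-exception j₁ with any? (λ j → ¬? (TableTransitive? (H j)))
... | yes (j₀ , ¬tt₀) = j₀ , λ j j≢j₀ → decidable-stable (TableTransitive? (H j)) λ ¬tt →
        j≢j₀ (one-exception j j₀ (λ vt → ¬tt (VT⇒TableTransitive (H j) vt))
                                  (λ vt → ¬tt₀ (VT⇒TableTransitive (H j₀) vt)))
... | no none = j₁ , λ j _ → decidable-stable (TableTransitive? (H j)) λ ¬tt → none (j , ¬tt)

-- p(G) ≤ Σ p(G_i): glue optimal phylogeny digraphs of the pieces, each
-- relabelled by an automorphism so that the root of the piece is a source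
upper-bound : ∀ {n k} (G : Graph n) (Gs : Fin k → Subgraph G)
              → (∀ i → Connected (graph (Gs i)))
              → EdgePartition G Gs
              → (∀ (C : Cycle G) → ∃[ i ] CycleIn C (Gs i))
              → (∀ i j → ¬ VertexTransitive (graph (Gs i)) → ¬ VertexTransitive (graph (Gs j)) → i ≡ j)
              → (ps : Fin k → ℕ)
              → (∀ i → HasPhylogenyDigraph (graph (Gs i)) (ps i))
              → HasPhylogenyDigraph G (sumFin ps)
-- without pieces G has no edges, and the empty gluing works
upper-bound {k = 0} G Gs conn part cyc one-exception ps optimal =
  Glue.D G Gs part ps (λ ()) (λ ()) (λ ()) (λ ()) (λ ()) (λ ()) ,
  Glue.isPhylogeny G Gs part ps (λ ()) (λ ()) (λ ()) (λ ()) (λ ()) (λ ())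
upper-bound {k = suc _} G Gs conn part cyc one-exception ps optimal
  with exceptional-piece (λ j → graph (Gs j)) one-exception zero
... | j₀ , transitive = Glue.D G Gs part ps Ds phs root sourced pot pot-raise ,
                        Glue.isPhylogeny G Gs part ps Ds phs root sourced pot pot-raise
  where
  Opt : ∀ j → Digraph (Fin (size (Gs j)) ⊎ Fin (ps j))
  Opt j = proj₁ (optimal j)
  -- ranks are measured from a vertex s₀ of G_{j₀} that is a source of D_{j₀}
  s₀-source : ∃[ s₀ ] (∀ y → ¬ Arc (Opt j₀) y (inj₁ s₀))
  s₀-source = source (graph (Gs j₀)) (Opt j₀) (proj₂ (optimal j₀)) (proj₁ (conn j₀))
  open PieceRootsFrom G Gs conn part cyc (emb (Gs j₀) (proj₁ s₀-source))
  -- s₀ is the root of G_{j₀}; the other pieces are vertex transitive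
  rooted : ∀ j → Σ[ D ∈ Digraph (Fin (size (Gs j)) ⊎ Fin (ps j)) ]
                   (IsPhylogenyDigraph (graph (Gs j)) (ps j) D × (∀ y → ¬ Arc D y (inj₁ (root j))))
  rooted j with j ≟ j₀
  ... | yes refl = Opt j , proj₂ (optimal j) ,
                   subst (λ r → ∀ y → ¬ Arc (Opt j) y (inj₁ r)) (root-s j _ refl) (proj₂ s₀-source)
  ... | no j≢j₀ = source-anywhere (graph (Gs j)) (transitive j j≢j₀) (Opt j) (proj₂ (optimal j)) (root j)
  Ds : ∀ j → Digraph (Fin (size (Gs j)) ⊎ Fin (ps j))
  Ds j = proj₁ (rooted j)
  phs : ∀ j → IsPhylogenyDigraph (graph (Gs j)) (ps j) (Ds j)
  phs j = proj₁ (proj₂ (rooted j))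
  sourced : ∀ j y → ¬ Arc (Ds j) y (inj₁ (root j))
  sourced j = proj₂ (proj₂ (rooted j))

-- Σ p(G_i) ≤ p(G): every phylogeny digraph of G restricts to the pieces,
-- which share no extra vertices
lower-bound : ∀ {n k} (G : Graph n) (Gs : Fin k → Subgraph G)
              → (∀ i → Connected (graph (Gs i)))
              → EdgePartition G Gs
              → (∀ (C : Cycle G) → ∃[ i ] CycleIn C (Gs i))
              → (ps : Fin k → ℕ)
              → (∀ i → IsPhylogenyNumber (graph (Gs i)) (ps i))
              → ∀ m → HasPhylogenyDigraph G m → sumFin ps ≤ m
lower-bound G Gs conn part cyc ps pn m (D , ph) =
  ≤-trans (sumFin-mono (λ i → proj₂ (pn i) (extras i) (restrict i))) extras-bound
  where open Restrict G Gs conn part cyc m D ph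

theorem6 : ∀ {n k} (G : Graph n) (Gs : Fin k → Subgraph G)
    → (∀ i → Connected (graph (Gs i)))
    → EdgePartition G Gs
    → (∀ (C : Cycle G) → ∃[ i ] CycleIn C (Gs i))
    → (∀ i j → ¬ VertexTransitive (graph (Gs i))
    → ¬ VertexTransitive (graph (Gs j)) → i ≡ j)
    → (ps : Fin k → ℕ)
    → (∀ i → IsPhylogenyNumber (graph (Gs i)) (ps i))
    → IsPhylogenyNumber G (sumFin ps)
theorem6 G Gs conn part cyc one-exception ps optimal =
  upper-bound G Gs conn part cyc one-exception ps (λ i → proj₁ (optimal i)) ,
  lower-bound G Gs conn part cyc ps optimal
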